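{- Let $A\in\mathbb{Z}^{d\times n}$, $a\in\mathbb{Z}^d$, and let $B$ be the integer matrix obtained by appending to $A$ finitely many (at least two) columns, each of which equals $a$ or $-a$. Then \[ \phi_n(\mathcal{G}_{\mathrm{IP}}(B))=\phi_n\big(\mathcal{G}_{\mathrm{IP}}(\begin{pmatrix}A & a\end{pmatrix})\big)\cup\{0\}, \] where $\phi_n$ denotes projection of a vector onto its first $n$ components and $\phi_n(G)$ is the set of images of elements of $G$.
   Context: For $u,v\in\mathbb{Z}^m$ write $u\sqsubseteq v$ if $u^{(j)}v^{(j)}\ge 0$ and $|u^{(j)}|\le |v^{(j)}|$ for all components $j$. For an integer matrix $M$ with $m$ columns, the Graver basis $\mathcal{G}_{\mathrm{IP}}(M)$ is the set of all $\sqsubseteq$-minimal elements of $\{z\in\mathbb{Z}^m\setminus\{0\}: Mz=0\}$. -}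

module Defs where

open import Data.Nat using (ℕ; zero; suc)
open import Data.Integer using (ℤ; +_; -_; _+_; _*_; _≤_; ∣_∣; 0ℤ)
import Data.Nat as ℕ
open import Data.Vec using (Vec; []; _∷_; _++_; replicate; zipWith; foldr; take; map)
open import Data.Product using (Σ; _×_; _,_; ∃)
open import Data.Sum using (_⊎_)
open import Relation.Binary.PropositionalEquality using (_≡_)
open import Relation.Nullary using (¬_)

-- An integer matrix with d rows and m columns, given as its vector of columns.
Matrix : ℕ → ℕ → Set
Matrix d m = Vec (Vec ℤ d) m

zeroVec : ∀ {k} → Vec ℤ k
zeroVec = replicate _ 0ℤ

_+ᵥ_ : ∀ {k} → Vec ℤ k → Vec ℤ k → Vec ℤ k
_+ᵥ_ = zipWith _+_

_·ᵥ_ : ∀ {k} → ℤ → Vec ℤ k → Vec ℤ k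
c ·ᵥ v = map (c *_) v

mulVec : ∀ {d m} → Matrix d m → Vec ℤ m → Vec ℤ d
mulVec [] [] = zeroVec
mulVec (c ∷ cs) (x ∷ xs) = (x ·ᵥ c) +ᵥ mulVec cs xs

data _⊑_ : ∀ {k} → Vec ℤ k → Vec ℤ k → Set where
  []  : [] ⊑ []
  _∷_ : ∀ {k x y} {xs ys : Vec ℤ k} →
        (0ℤ ≤ x * y × ∣ x ∣ ℕ.≤ ∣ y ∣) → xs ⊑ ys → (x ∷ xs) ⊑ (y ∷ ys)

InKernel : ∀ {d m} → Matrix d m → Vec ℤ m → Set
InKernel M z = ¬ (z ≡ zeroVec) × mulVec M z ≡ zeroVec

InGraver : ∀ {d m} → Matrix d m → Vec ℤ m → Set
InGraver M z = InKernel M z × (∀ u → InKernel M u → u ⊑ z → u ≡ z)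

data Sign : Set where
  plus minus : Sign

signed : ∀ {d} → Sign → Vec ℤ d → Vec ℤ d
signed plus  a = a
signed minus a = map -_ a

InProjGraver : ∀ {d} n k → Matrix d (n ℕ.+ k) → Vec ℤ n → Set
InProjGraver n k M w = ∃ λ z → InGraver M z × take n z ≡ w

-- Write a vector of the kernel as (x, y) with y the coordinates of the appended columns ±a.
-- Flipping the signs of the y-coordinates to match the columns is a bijection of Graver
-- bases, so all appended columns may be taken equal to a; then B (x, y) = A x + (Σ y) a.
-- A Graver element (x, y) of B with x ≠ 0 collapses to the Graver element (x, Σ y) of (A a):
-- minimality survives because every t ⊑ Σ y is the sum Σ y′ of some y′ ⊑ y (the sums of
-- the y′ ⊑ y fill the interval from the sum of the negative to the sum of the positive
-- entries of y). Conversely (x, t) expands to (x, t, 0, …, 0). Finally 0 is a projection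
-- because of (0, 1, −1, 0, …, 0) when a ≠ 0, and of (0, 1, 0, …, 0) when a = 0.

module Submission where

open import Defs
open import Data.Nat using (ℕ; _≥_)
open import Data.Integer using (ℤ)
open import Data.Vec using (Vec; _∷_; []; _++_; map)
open import Data.Sum using (_⊎_)
open import Relation.Binary.PropositionalEquality using (_≡_)
open import Function.Bundles using (_⇔_)

import Data.Nat as ℕ
open import Data.Nat using (zero; suc; z≤n; s≤s)
open import Data.Nat.Properties using (n≤0⇒n≡0)
open import Data.Integer
  using (+_; -[1+_]; +[1+_]; +0; 0ℤ; 1ℤ; -1ℤ; _+_; _-_; -_; _*_; _≤_; _≤?_; _⊓_; _⊔_; ∣_∣; +≤+; -≤-; -≤+)
open import Data.Integer.Properties
  using (_≟_; ≤-refl; ≤-trans; ≤-antisym; <⇒≤; ≰⇒>; +-identityˡ; +-identityʳ; +-assoc; +-mono-≤; +-monoˡ-≤;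
         *-zeroʳ; *-distribʳ-+; pos-*; neg-involutive; neg-distribˡ-*; neg-distribʳ-*; ∣-i∣≡∣i∣; ∣i∣≡0⇒i≡0;
         i*j≡0⇒i≡0∨j≡0; i≤j⇒0≤j-i; i≤j⇒i-j≤0; i⊓j≤i; i⊓j≤j; i≤i⊔j; i≤j⊔i; i≥j⇒i⊓j≡j; i≥j⇒i⊔j≡i;
         +-0-abelianGroup)
open import Data.Vec using (replicate; zipWith; take; drop; splitAt; head)
open import Data.Vec.Properties
  using (++-injective; ∷-injectiveˡ; ∷-injectiveʳ; ≡-dec; map-const; map-replicate;
         zipWith-assoc; zipWith-identityˡ; zipWith-identityʳ)
open import Data.Product using (_×_; _,_; ∃; ∃₂; proj₁; proj₂)
open import Data.Sum using (inj₁; inj₂; [_,_])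
open import Function.Base using (_∘_)
open import Function.Bundles using (mk⇔)
open import Function.Properties.Equivalence using () renaming (trans to ⇔-trans)
open import Relation.Nullary using (¬_; yes; no; contradiction)
open import Relation.Binary.PropositionalEquality
  using (refl; sym; trans; cong; cong₂; subst; subst₂; module ≡-Reasoning)
open import Algebra.Properties.AbelianGroup +-0-abelianGroup using (//-rightDividesˡ; //-rightDividesʳ)

open ≡-Reasoning

infix 4 _⊑ᶻ_

_⊑ᶻ_ : ℤ → ℤ → Set
i ⊑ᶻ j = 0ℤ ≤ i * j × ∣ i ∣ ℕ.≤ ∣ j ∣

0⊑ᶻ : ∀ j → 0ℤ ⊑ᶻ j
0⊑ᶻ j = +≤+ z≤n , z≤n

0≤i≤j⇒i⊑ᶻj : ∀ {i j} → 0ℤ ≤ i → i ≤ j → i ⊑ᶻ j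
0≤i≤j⇒i⊑ᶻj {+ m} {+ n} _ (+≤+ m≤n) rewrite sym (pos-* m n) = +≤+ z≤n , m≤n

j≤i≤0⇒i⊑ᶻj : ∀ {i j} → j ≤ i → i ≤ 0ℤ → i ⊑ᶻ j
j≤i≤0⇒i⊑ᶻj {+0}        {j}         _         _         = 0⊑ᶻ j
j≤i≤0⇒i⊑ᶻj { -[1+ m ]} { -[1+ n ]} (-≤- m≤n) _         = +≤+ z≤n , s≤s m≤n
j≤i≤0⇒i⊑ᶻj {+[1+ m ]}  {_}         _         (+≤+ ())

⊑ᶻ⇒between : ∀ {i j} → i ⊑ᶻ j → (0ℤ ≤ i × i ≤ j) ⊎ (j ≤ i × i ≤ 0ℤ)
⊑ᶻ⇒between {+0}        {+ n}       _              = inj₁ (+≤+ z≤n , +≤+ z≤n)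
⊑ᶻ⇒between {+0}        { -[1+ n ]} _              = inj₂ (-≤+ , +≤+ z≤n)
⊑ᶻ⇒between {+[1+ m ]}  {+ n}       (_ , m<n)      = inj₁ (+≤+ z≤n , +≤+ m<n)
⊑ᶻ⇒between {+[1+ m ]}  { -[1+ n ]} (() , _)
⊑ᶻ⇒between { -[1+ m ]} {+0}        (_ , ())
⊑ᶻ⇒between { -[1+ m ]} {+[1+ n ]}  (() , _)
⊑ᶻ⇒between { -[1+ m ]} { -[1+ n ]} (_ , s≤s m≤n) = inj₂ (-≤- m≤n , -≤+)

⊑ᶻ-unit : ∀ {i} j → ∣ j ∣ ≡ 1 → i ⊑ᶻ j → i ≡ 0ℤ ⊎ i ≡ j
⊑ᶻ-unit {+0}            _           _    _             = inj₁ refl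
⊑ᶻ-unit {+[1+ zero ]}   +[1+ zero ] refl _             = inj₂ refl
⊑ᶻ-unit {+[1+ suc m ]}  +[1+ zero ] refl (_ , s≤s ())
⊑ᶻ-unit { -[1+ m ]}     +[1+ zero ] refl (() , _)
⊑ᶻ-unit {+[1+ m ]}      -[1+ zero ] refl (() , _)
⊑ᶻ-unit { -[1+ zero ]}  -[1+ zero ] refl _             = inj₂ refl
⊑ᶻ-unit { -[1+ suc m ]} -[1+ zero ] refl (_ , s≤s ())

signedᶻ : Sign → ℤ → ℤ
signedᶻ plus  i = i
signedᶻ minus i = - i

signedᶻ-involutive : ∀ σ i → signedᶻ σ (signedᶻ σ i) ≡ i
signedᶻ-involutive plus  i = refl
signedᶻ-involutive minus i = neg-involutive i

⊑ᶻ-signedᶻ : ∀ σ {i j} → i ⊑ᶻ signedᶻ σ j → signedᶻ σ i ⊑ᶻ j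
⊑ᶻ-signedᶻ plus              i⊑j                = i⊑j
⊑ᶻ-signedᶻ minus {i} {j} (0≤i*-j , ∣i∣≤∣-j∣) =
  subst (0ℤ ≤_) (trans (sym (neg-distribʳ-* i j)) (neg-distribˡ-* i j)) 0≤i*-j ,
  subst₂ ℕ._≤_ (sym (∣-i∣≡∣i∣ i)) (∣-i∣≡∣i∣ j) ∣i∣≤∣-j∣

signedEntries : ∀ {k} → Vec Sign k → Vec ℤ k → Vec ℤ k
signedEntries = zipWith signedᶻ

signedEntries-involutive : ∀ {k} (s : Vec Sign k) y → signedEntries s (signedEntries s y) ≡ y
signedEntries-involutive []      []      = refl
signedEntries-involutive (σ ∷ s) (i ∷ y) = cong₂ _∷_ (signedᶻ-involutive σ i) (signedEntries-involutive s y)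

signedEntries-zeroVec : ∀ {k} (s : Vec Sign k) → signedEntries s zeroVec ≡ zeroVec
signedEntries-zeroVec []          = refl
signedEntries-zeroVec (plus  ∷ s) = cong (0ℤ ∷_) (signedEntries-zeroVec s)
signedEntries-zeroVec (minus ∷ s) = cong (0ℤ ∷_) (signedEntries-zeroVec s)

⊑-signedEntries : ∀ {k} (s : Vec Sign k) {v y} → v ⊑ signedEntries s y → signedEntries s v ⊑ y
⊑-signedEntries []      {[]}    {[]}    []            = []
⊑-signedEntries (σ ∷ s) {_ ∷ _} {_ ∷ _} (i⊑j ∷ v⊑y) = ⊑ᶻ-signedᶻ σ i⊑j ∷ ⊑-signedEntries s v⊑y

·ᵥ-zeroˡ : ∀ {k} (v : Vec ℤ k) → 0ℤ ·ᵥ v ≡ zeroVec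
·ᵥ-zeroˡ v = map-const v 0ℤ

·ᵥ-zeroʳ : ∀ {k} i → i ·ᵥ zeroVec {k} ≡ zeroVec
·ᵥ-zeroʳ {k} i = trans (map-replicate (i *_) 0ℤ k) (cong (replicate k) (*-zeroʳ i))

·ᵥ-distribʳ : ∀ {k} i j (v : Vec ℤ k) → (i ·ᵥ v) +ᵥ (j ·ᵥ v) ≡ (i + j) ·ᵥ v
·ᵥ-distribʳ i j []      = refl
·ᵥ-distribʳ i j (x ∷ v) = cong₂ _∷_ (sym (*-distribʳ-+ x i j)) (·ᵥ-distribʳ i j v)

·ᵥ-cancelʳ : ∀ {k} i (v : Vec ℤ k) → ¬ v ≡ zeroVec → i ·ᵥ v ≡ zeroVec → i ≡ 0ℤ
·ᵥ-cancelʳ i []      v≢0 _ = contradiction refl v≢0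
·ᵥ-cancelʳ i (x ∷ v) v≢0 iv≡0 with i*j≡0⇒i≡0∨j≡0 i (∷-injectiveˡ iv≡0)
... | inj₁ i≡0 = i≡0
... | inj₂ refl = ·ᵥ-cancelʳ i v (v≢0 ∘ cong (0ℤ ∷_)) (∷-injectiveʳ iv≡0)

·ᵥ-signed : ∀ {k} σ i (v : Vec ℤ k) → i ·ᵥ signed σ v ≡ signedᶻ σ i ·ᵥ v
·ᵥ-signed plus  i v       = refl
·ᵥ-signed minus i []      = refl
·ᵥ-signed minus i (x ∷ v) =
  cong₂ _∷_ (trans (sym (neg-distribʳ-* i x)) (neg-distribˡ-* i x)) (·ᵥ-signed minus i v)

zeroVec-++ : ∀ m {n} → zeroVec {m} ++ zeroVec {n} ≡ zeroVec
zeroVec-++ zero    = refl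
zeroVec-++ (suc m) = cong (0ℤ ∷_) (zeroVec-++ m)

++-≡-zeroVec⁻ : ∀ {m n} (x : Vec ℤ m) {y : Vec ℤ n} → x ++ y ≡ zeroVec → x ≡ zeroVec × y ≡ zeroVec
++-≡-zeroVec⁻ {m} x x++y≡0 = ++-injective x zeroVec (trans x++y≡0 (sym (zeroVec-++ m)))

++-≢-zeroVec : ∀ {m n n′} (x : Vec ℤ m) {y : Vec ℤ n} {y′ : Vec ℤ n′} →
               (y′ ≡ zeroVec → y ≡ zeroVec) → ¬ x ++ y ≡ zeroVec → ¬ x ++ y′ ≡ zeroVec
++-≢-zeroVec {m} x y′≡0⇒y≡0 x++y≢0 x++y′≡0 with ++-≡-zeroVec⁻ x x++y′≡0
... | refl , y′≡0 = x++y≢0 (trans (cong (zeroVec ++_) (y′≡0⇒y≡0 y′≡0)) (zeroVec-++ m))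

take-++ : ∀ {A : Set} {m n} (x : Vec A m) (y : Vec A n) → take m (x ++ y) ≡ x
take-++ []      y = refl
take-++ (i ∷ x) y = cong (i ∷_) (take-++ x y)

drop-++ : ∀ {A : Set} {m n} (x : Vec A m) (y : Vec A n) → drop m (x ++ y) ≡ y
drop-++ []      y = refl
drop-++ (i ∷ x) y = drop-++ x y

⊑-++⁺ : ∀ {m n} {x x′ : Vec ℤ m} {y y′ : Vec ℤ n} → x ⊑ x′ → y ⊑ y′ → (x ++ y) ⊑ (x′ ++ y′)
⊑-++⁺ []            y⊑y′ = y⊑y′
⊑-++⁺ (i⊑j ∷ x⊑x′) y⊑y′ = i⊑j ∷ ⊑-++⁺ x⊑x′ y⊑y′

⊑-++⁻ : ∀ {m n} (x x′ : Vec ℤ m) {y y′ : Vec ℤ n} → (x ++ y) ⊑ (x′ ++ y′) → x ⊑ x′ × y ⊑ y′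
⊑-++⁻ []      []       y⊑y′          = [] , y⊑y′
⊑-++⁻ (_ ∷ x) (_ ∷ x′) (i⊑j ∷ x++y⊑) = let x⊑x′ , y⊑y′ = ⊑-++⁻ x x′ x++y⊑ in i⊑j ∷ x⊑x′ , y⊑y′

⊑zeroVec⇒≡zeroVec : ∀ {k} {v : Vec ℤ k} → v ⊑ zeroVec → v ≡ zeroVec
⊑zeroVec⇒≡zeroVec []                 = refl
⊑zeroVec⇒≡zeroVec ((_ , ∣i∣≤0) ∷ v⊑0) = cong₂ _∷_ (∣i∣≡0⇒i≡0 (n≤0⇒n≡0 ∣i∣≤0)) (⊑zeroVec⇒≡zeroVec v⊑0)

mulVec-++ : ∀ {d m n} (A : Matrix d m) (B : Matrix d n) x y →
            mulVec (A ++ B) (x ++ y) ≡ mulVec A x +ᵥ mulVec B y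
mulVec-++ []      B []      y = sym (zipWith-identityˡ +-identityˡ (mulVec B y))
mulVec-++ (c ∷ A) B (i ∷ x) y = begin
  (i ·ᵥ c) +ᵥ mulVec (A ++ B) (x ++ y)      ≡⟨ cong ((i ·ᵥ c) +ᵥ_) (mulVec-++ A B x y) ⟩
  (i ·ᵥ c) +ᵥ (mulVec A x +ᵥ mulVec B y)   ≡⟨ zipWith-assoc +-assoc (i ·ᵥ c) (mulVec A x) (mulVec B y) ⟨
  ((i ·ᵥ c) +ᵥ mulVec A x) +ᵥ mulVec B y   ∎

mulVec-zeroVec : ∀ {d m} (A : Matrix d m) → mulVec A zeroVec ≡ zeroVec
mulVec-zeroVec []      = refl
mulVec-zeroVec (c ∷ A) =
  trans (cong₂ _+ᵥ_ (·ᵥ-zeroˡ c) (mulVec-zeroVec A)) (zipWith-identityˡ +-identityˡ zeroVec)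

sum : ∀ {k} → Vec ℤ k → ℤ
sum []      = 0ℤ
sum (i ∷ y) = i + sum y

sum-zeroVec : ∀ k → sum (zeroVec {k}) ≡ 0ℤ
sum-zeroVec zero    = refl
sum-zeroVec (suc k) = trans (+-identityˡ _) (sum-zeroVec k)

mulVec-replicate : ∀ {d k} (a : Vec ℤ d) (y : Vec ℤ k) → mulVec (replicate k a) y ≡ sum y ·ᵥ a
mulVec-replicate a []      = sym (·ᵥ-zeroˡ a)
mulVec-replicate a (i ∷ y) =
  trans (cong ((i ·ᵥ a) +ᵥ_) (mulVec-replicate a y)) (·ᵥ-distribʳ i (sum y) a)

mulVec-signed : ∀ {d k} (a : Vec ℤ d) (s : Vec Sign k) y →
                mulVec (map (λ σ → signed σ a) s) y ≡ mulVec (replicate k a) (signedEntries s y)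
mulVec-signed a []      []      = refl
mulVec-signed a (σ ∷ s) (i ∷ y) = cong₂ _+ᵥ_ (·ᵥ-signed σ i a) (mulVec-signed a s y)

negativeSum positiveSum : ∀ {k} → Vec ℤ k → ℤ
negativeSum y = sum (map (_⊓ 0ℤ) y)
positiveSum y = sum (map (_⊔ 0ℤ) y)

negativeSum≤0 : ∀ {k} (y : Vec ℤ k) → negativeSum y ≤ 0ℤ
negativeSum≤0 []      = ≤-refl
negativeSum≤0 (i ∷ y) = +-mono-≤ (i⊓j≤j i 0ℤ) (negativeSum≤0 y)

negativeSum≤sum : ∀ {k} (y : Vec ℤ k) → negativeSum y ≤ sum y
negativeSum≤sum []      = ≤-refl
negativeSum≤sum (i ∷ y) = +-mono-≤ (i⊓j≤i i 0ℤ) (negativeSum≤sum y)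

0≤positiveSum : ∀ {k} (y : Vec ℤ k) → 0ℤ ≤ positiveSum y
0≤positiveSum []      = ≤-refl
0≤positiveSum (i ∷ y) = +-mono-≤ (i≤j⊔i i 0ℤ) (0≤positiveSum y)

sum≤positiveSum : ∀ {k} (y : Vec ℤ k) → sum y ≤ positiveSum y
sum≤positiveSum []      = ≤-refl
sum≤positiveSum (i ∷ y) = +-mono-≤ (i≤i⊔j i 0ℤ) (sum≤positiveSum y)

-- t′ is t clamped to [L, U]; the part cut off lies between 0 and i.
split-clamped : ∀ i {L U t} → L ≤ 0ℤ → 0ℤ ≤ U → i ⊓ 0ℤ + L ≤ t → t ≤ i ⊔ 0ℤ + U →
                ∃₂ λ i′ t′ → i′ ⊑ᶻ i × L ≤ t′ × t′ ≤ U × i′ + t′ ≡ t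
split-clamped (+ m) {L} {U} {t} L≤0 0≤U lo hi
  rewrite i≥j⇒i⊓j≡j {+ m} {0ℤ} (+≤+ z≤n) | i≥j⇒i⊔j≡i {+ m} {0ℤ} (+≤+ z≤n) with t ≤? U
... | yes t≤U = 0ℤ , t , 0⊑ᶻ (+ m) , subst (_≤ t) (+-identityˡ L) lo , t≤U , +-identityˡ t
... | no  t≰U = t - U , U , 0≤i≤j⇒i⊑ᶻj 0≤t-U t-U≤m , ≤-trans L≤0 0≤U , ≤-refl , //-rightDividesˡ U t
  where
  0≤t-U : 0ℤ ≤ t - U
  0≤t-U = i≤j⇒0≤j-i (<⇒≤ (≰⇒> t≰U))
  t-U≤m : t - U ≤ + m
  t-U≤m = subst (t - U ≤_) (//-rightDividesʳ U (+ m)) (+-monoˡ-≤ (- U) hi)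
split-clamped -[1+ m ] {L} {U} {t} L≤0 0≤U lo hi with L ≤? t
... | yes L≤t = 0ℤ , t , 0⊑ᶻ -[1+ m ] , L≤t , subst (t ≤_) (+-identityˡ U) hi , +-identityˡ t
... | no  L≰t = t - L , L , j≤i≤0⇒i⊑ᶻj -m≤t-L t-L≤0 , ≤-refl , ≤-trans L≤0 0≤U , //-rightDividesˡ L t
  where
  -m≤t-L : -[1+ m ] ≤ t - L
  -m≤t-L = subst (_≤ t - L) (//-rightDividesʳ L -[1+ m ]) (+-monoˡ-≤ (- L) lo)
  t-L≤0 : t - L ≤ 0ℤ
  t-L≤0 = i≤j⇒i-j≤0 (<⇒≤ (≰⇒> L≰t))

sum-⊑-lift-between : ∀ {k} (y : Vec ℤ k) {t} → negativeSum y ≤ t → t ≤ positiveSum y →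
                     ∃ λ y′ → y′ ⊑ y × sum y′ ≡ t
sum-⊑-lift-between []      lo hi = [] , [] , ≤-antisym lo hi
sum-⊑-lift-between (i ∷ y) lo hi
  with split-clamped i (negativeSum≤0 y) (0≤positiveSum y) lo hi
... | i′ , t′ , i′⊑i , lo′ , hi′ , i′+t′≡t with sum-⊑-lift-between y lo′ hi′
... | y′ , y′⊑y , refl = i′ ∷ y′ , i′⊑i ∷ y′⊑y , i′+t′≡t

sum-⊑-lift : ∀ {k} (y : Vec ℤ k) {t} → t ⊑ᶻ sum y → ∃ λ y′ → y′ ⊑ y × sum y′ ≡ t
sum-⊑-lift y t⊑y with ⊑ᶻ⇒between t⊑y
... | inj₁ (0≤t , t≤s) =
  sum-⊑-lift-between y (≤-trans (negativeSum≤0 y) 0≤t) (≤-trans t≤s (sum≤positiveSum y))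
... | inj₂ (s≤t , t≤0) =
  sum-⊑-lift-between y (≤-trans (negativeSum≤sum y) s≤t) (≤-trans t≤0 (0≤positiveSum y))

InGraver-transport : ∀ {d m m′} (M : Matrix d m) (M′ : Matrix d m′) (f : Vec ℤ m → Vec ℤ m′) →
                     (∀ u → mulVec M′ (f u) ≡ mulVec M u) → f zeroVec ≡ zeroVec →
                     ∀ {z} → (∀ v → v ⊑ f z → ∃ λ u → u ⊑ z × f u ≡ v) → ¬ f z ≡ zeroVec →
                     InGraver M z → InGraver M′ (f z)
InGraver-transport M M′ f f-mulVec f-zero {z} lift fz≢0 ((_ , Mz≡0) , minimal) =
  (fz≢0 , trans (f-mulVec z) Mz≡0) , minimal′
  where
  minimal′ : ∀ v → InKernel M′ v → v ⊑ f z → v ≡ f z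
  minimal′ v (v≢0 , M′v≡0) v⊑fz with lift v v⊑fz
  ... | u , u⊑z , refl = cong f (minimal u (u≢0 , trans (sym (f-mulVec u)) M′v≡0) u⊑z)
    where
    u≢0 : ¬ u ≡ zeroVec
    u≢0 refl = v≢0 f-zero

module _ {d n j j′} (A : Matrix d n) (C : Matrix d j) (C′ : Matrix d j′) (g : Vec ℤ j → Vec ℤ j′)
         (g-mulVec : ∀ y → mulVec C′ (g y) ≡ mulVec C y) (g-zero : g zeroVec ≡ zeroVec) where

  private
    mapTail : Vec ℤ (n ℕ.+ j) → Vec ℤ (n ℕ.+ j′)
    mapTail z = take n z ++ g (drop n z)

    mapTail-++ : ∀ x y → mapTail (x ++ y) ≡ x ++ g y
    mapTail-++ x y = cong₂ (λ x′ y′ → x′ ++ g y′) (take-++ x y) (drop-++ x y)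

    mulVec-mapTail : ∀ z → mulVec (A ++ C′) (mapTail z) ≡ mulVec (A ++ C) z
    mulVec-mapTail z with splitAt n z
    ... | x , y , refl = begin
      mulVec (A ++ C′) (x ++ g y)          ≡⟨ mulVec-++ A C′ x (g y) ⟩
      mulVec A x +ᵥ mulVec C′ (g y)        ≡⟨ cong (mulVec A x +ᵥ_) (g-mulVec y) ⟩
      mulVec A x +ᵥ mulVec C y             ≡⟨ mulVec-++ A C x y ⟨
      mulVec (A ++ C) (x ++ y)             ∎

    mapTail-zeroVec : mapTail zeroVec ≡ zeroVec
    mapTail-zeroVec = begin
      mapTail zeroVec                  ≡⟨ cong mapTail (zeroVec-++ n) ⟨
      mapTail (zeroVec {n} ++ zeroVec) ≡⟨ mapTail-++ zeroVec zeroVec ⟩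
      zeroVec {n} ++ g zeroVec         ≡⟨ cong (zeroVec ++_) g-zero ⟩
      zeroVec {n} ++ zeroVec           ≡⟨ zeroVec-++ n ⟩
      zeroVec                          ∎

  InGraver-mapTail : ∀ {x y} → (∀ v → v ⊑ g y → ∃ λ y′ → y′ ⊑ y × g y′ ≡ v) →
                     ¬ x ++ g y ≡ zeroVec → InGraver (A ++ C) (x ++ y) → InGraver (A ++ C′) (x ++ g y)
  InGraver-mapTail {x} {y} lift x++gy≢0 =
    subst (InGraver (A ++ C′)) (mapTail-++ x y)
    ∘ InGraver-transport (A ++ C) (A ++ C′) mapTail mulVec-mapTail mapTail-zeroVec lift′
                         (x++gy≢0 ∘ trans (sym (mapTail-++ x y)))
    where
    lift′ : ∀ v → v ⊑ mapTail (x ++ y) → ∃ λ u → u ⊑ (x ++ y) × mapTail u ≡ v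
    lift′ v v⊑ with splitAt n v
    ... | v₁ , v₂ , refl with ⊑-++⁻ v₁ x (subst ((v₁ ++ v₂) ⊑_) (mapTail-++ x y) v⊑)
    ... | v₁⊑x , v₂⊑gy with lift v₂ v₂⊑gy
    ... | y′ , y′⊑y , refl = v₁ ++ y′ , ⊑-++⁺ v₁⊑x y′⊑y , mapTail-++ v₁ y′

InGraver-padLeft : ∀ {d n j} (A : Matrix d n) (C : Matrix d j) {y} →
                   InGraver C y → InGraver (A ++ C) (zeroVec ++ y)
InGraver-padLeft {n = n} A C {y} G@((y≢0 , _) , _) =
  InGraver-transport C (A ++ C) (zeroVec ++_) mulVec-padLeft (zeroVec-++ n) lift
                     (y≢0 ∘ proj₂ ∘ ++-≡-zeroVec⁻ zeroVec) G
  where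
  mulVec-padLeft : ∀ u → mulVec (A ++ C) (zeroVec ++ u) ≡ mulVec C u
  mulVec-padLeft u = begin
    mulVec (A ++ C) (zeroVec ++ u)        ≡⟨ mulVec-++ A C zeroVec u ⟩
    mulVec A zeroVec +ᵥ mulVec C u        ≡⟨ cong (_+ᵥ mulVec C u) (mulVec-zeroVec A) ⟩
    zeroVec +ᵥ mulVec C u                 ≡⟨ zipWith-identityˡ +-identityˡ (mulVec C u) ⟩
    mulVec C u                            ∎
  lift : ∀ v → v ⊑ (zeroVec ++ y) → ∃ λ u → u ⊑ y × zeroVec ++ u ≡ v
  lift v v⊑ with splitAt n v
  ... | v₁ , v₂ , refl with ⊑-++⁻ v₁ zeroVec v⊑
  ... | v₁⊑0 , v₂⊑y = v₂ , v₂⊑y , cong (_++ v₂) (sym (⊑zeroVec⇒≡zeroVec v₁⊑0))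

InGraver-unit : ∀ {d j} (C : Matrix d j) → InGraver (zeroVec ∷ C) (1ℤ ∷ zeroVec)
InGraver-unit C = ((λ ()) , kernel) , minimal
  where
  kernel : mulVec (zeroVec ∷ C) (1ℤ ∷ zeroVec) ≡ zeroVec
  kernel = trans (cong₂ _+ᵥ_ (·ᵥ-zeroʳ 1ℤ) (mulVec-zeroVec C)) (zipWith-identityˡ +-identityˡ zeroVec)
  minimal : ∀ v → InKernel (zeroVec ∷ C) v → v ⊑ (1ℤ ∷ zeroVec) → v ≡ 1ℤ ∷ zeroVec
  minimal (t ∷ v) (t∷v≢0 , _) (t⊑1 ∷ v⊑0) with ⊑zeroVec⇒≡zeroVec v⊑0 | ⊑ᶻ-unit {t} 1ℤ refl t⊑1
  ... | refl | inj₁ refl = contradiction refl t∷v≢0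
  ... | refl | inj₂ refl = refl

InGraver-pair : ∀ {d j} {a : Vec ℤ d} (C : Matrix d j) → ¬ a ≡ zeroVec →
                InGraver (a ∷ a ∷ C) (1ℤ ∷ -1ℤ ∷ zeroVec)
InGraver-pair {a = a} C a≢0 = ((λ ()) , trans (mulVec-pair 1ℤ -1ℤ) (·ᵥ-zeroˡ a)) , minimal
  where
  mulVec-pair : ∀ t₁ t₂ → mulVec (a ∷ a ∷ C) (t₁ ∷ t₂ ∷ zeroVec) ≡ (t₁ + t₂) ·ᵥ a
  mulVec-pair t₁ t₂ = begin
    (t₁ ·ᵥ a) +ᵥ ((t₂ ·ᵥ a) +ᵥ mulVec C zeroVec)
      ≡⟨ cong (λ v → (t₁ ·ᵥ a) +ᵥ ((t₂ ·ᵥ a) +ᵥ v)) (mulVec-zeroVec C) ⟩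
    (t₁ ·ᵥ a) +ᵥ ((t₂ ·ᵥ a) +ᵥ zeroVec)
      ≡⟨ cong ((t₁ ·ᵥ a) +ᵥ_) (zipWith-identityʳ +-identityʳ (t₂ ·ᵥ a)) ⟩
    (t₁ ·ᵥ a) +ᵥ (t₂ ·ᵥ a)
      ≡⟨ ·ᵥ-distribʳ t₁ t₂ a ⟩
    (t₁ + t₂) ·ᵥ a
      ∎
  minimal : ∀ v → InKernel (a ∷ a ∷ C) v → v ⊑ (1ℤ ∷ -1ℤ ∷ zeroVec) → v ≡ 1ℤ ∷ -1ℤ ∷ zeroVec
  minimal (t₁ ∷ t₂ ∷ v) (v≢0 , kernel) (t₁⊑1 ∷ t₂⊑-1 ∷ v⊑0) with ⊑zeroVec⇒≡zeroVec v⊑0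
  ... | refl with ⊑ᶻ-unit {t₁} 1ℤ refl t₁⊑1 | ⊑ᶻ-unit {t₂} -1ℤ refl t₂⊑-1
                | ·ᵥ-cancelʳ (t₁ + t₂) a a≢0 (trans (sym (mulVec-pair t₁ t₂)) kernel)
  ... | inj₁ refl | inj₁ refl | _  = contradiction refl v≢0
  ... | inj₂ refl | inj₂ refl | _  = refl
  ... | inj₁ refl | inj₂ refl | ()
  ... | inj₂ refl | inj₁ refl | ()

InProjGraver-intro : ∀ {d n k} (M : Matrix d (n ℕ.+ k)) {w} y → InGraver M (w ++ y) → InProjGraver n k M w
InProjGraver-intro M {w} y G = w ++ y , G , take-++ w y

InProjGraver-elim : ∀ {d n k} (M : Matrix d (n ℕ.+ k)) {w} → InProjGraver n k M w → ∃ λ y → InGraver M (w ++ y)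
InProjGraver-elim {n = n} M (z , G , take-z≡w) with splitAt n z
... | x , y , refl = y , subst (λ x → InGraver M (x ++ y)) take-z≡w G

module _ {d n k} (A : Matrix d n) (a : Vec ℤ d) (s : Vec Sign k) where

  private
    signedEntries-transfer : ∀ C C′ → (∀ y → mulVec C′ (signedEntries s y) ≡ mulVec C y) →
               ∀ {w} → InProjGraver n k (A ++ C) w → InProjGraver n k (A ++ C′) w
    signedEntries-transfer C C′ g-mulVec {w} h with InProjGraver-elim (A ++ C) h
    ... | y , G@((w++y≢0 , _) , _) =
      InProjGraver-intro (A ++ C′) (signedEntries s y)
        (InGraver-mapTail A C C′ (signedEntries s) g-mulVec (signedEntries-zeroVec s) lift
                          (++-≢-zeroVec w signedEntries-reflects-zeroVec w++y≢0) G)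
      where
      lift : ∀ v → v ⊑ signedEntries s y → ∃ λ y′ → y′ ⊑ y × signedEntries s y′ ≡ v
      lift v v⊑ = signedEntries s v , ⊑-signedEntries s v⊑ , signedEntries-involutive s v
      signedEntries-reflects-zeroVec : signedEntries s y ≡ zeroVec → y ≡ zeroVec
      signedEntries-reflects-zeroVec sy≡0 = begin
        y                                      ≡⟨ signedEntries-involutive s y ⟨
        signedEntries s (signedEntries s y)    ≡⟨ cong (signedEntries s) sy≡0 ⟩
        signedEntries s zeroVec                ≡⟨ signedEntries-zeroVec s ⟩
        zeroVec                                ∎

  InProjGraver-signed⇔ : ∀ w → InProjGraver n k (A ++ map (λ σ → signed σ a) s) w
                               ⇔ InProjGraver n k (A ++ replicate k a) w
  InProjGraver-signed⇔ w = mk⇔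
    (signedEntries-transfer _ (replicate k a) λ y → sym (mulVec-signed a s y))
    (signedEntries-transfer (replicate k a) _ λ y →
      trans (mulVec-signed a s (signedEntries s y)) (cong (mulVec (replicate k a)) (signedEntries-involutive s y)))

module _ {d n} (A : Matrix d n) (a : Vec ℤ d) where

  InProjGraver-collapse : ∀ {k w} → InProjGraver n k (A ++ replicate k a) w →
                          InProjGraver n 1 (A ++ (a ∷ [])) w ⊎ w ≡ zeroVec
  InProjGraver-collapse {k} {w} h with InProjGraver-elim (A ++ replicate k a) h | ≡-dec _≟_ w zeroVec
  ... | _     | yes w≡0 = inj₂ w≡0
  ... | y , G | no  w≢0 = inj₁ (InProjGraver-intro (A ++ (a ∷ [])) (sum y ∷ [])
    (InGraver-mapTail A (replicate k a) (a ∷ []) (λ y → sum y ∷ []) mulVec-sum (cong (_∷ []) (sum-zeroVec k))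
                      lift (w≢0 ∘ proj₁ ∘ ++-≡-zeroVec⁻ w) G))
    where
    mulVec-sum : ∀ y → mulVec (a ∷ []) (sum y ∷ []) ≡ mulVec (replicate k a) y
    mulVec-sum y = trans (zipWith-identityʳ +-identityʳ (sum y ·ᵥ a)) (sym (mulVec-replicate a y))
    lift : ∀ v → v ⊑ (sum y ∷ []) → ∃ λ y′ → y′ ⊑ y × sum y′ ∷ [] ≡ v
    lift (t ∷ []) (t⊑sum ∷ []) = let y′ , y′⊑y , sum-y′≡t = sum-⊑-lift y t⊑sum in
                                  y′ , y′⊑y , cong (_∷ []) sum-y′≡t

  InProjGraver-expand : ∀ {k w} → InProjGraver n 1 (A ++ (a ∷ [])) w →
                        InProjGraver n (suc k) (A ++ replicate (suc k) a) w
  InProjGraver-expand {k} {w} h with InProjGraver-elim (A ++ (a ∷ [])) h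
  ... | t ∷ [] , G@((w++t≢0 , _) , _) = InProjGraver-intro (A ++ replicate (suc k) a) (t ∷ zeroVec)
    (InGraver-mapTail A (a ∷ []) (replicate (suc k) a) (λ y → head y ∷ zeroVec) mulVec-expand refl
                      lift (++-≢-zeroVec w (cong (_∷ []) ∘ ∷-injectiveˡ) w++t≢0) G)
    where
    mulVec-expand : ∀ y → mulVec (replicate (suc k) a) (head y ∷ zeroVec) ≡ mulVec (a ∷ []) y
    mulVec-expand (i ∷ []) = cong ((i ·ᵥ a) +ᵥ_) (mulVec-zeroVec (replicate k a))
    lift : ∀ v → v ⊑ (t ∷ zeroVec) → ∃ λ y′ → y′ ⊑ (t ∷ []) × head y′ ∷ zeroVec ≡ v
    lift (i ∷ v) (i⊑t ∷ v⊑0) = i ∷ [] , i⊑t ∷ [] , cong (i ∷_) (sym (⊑zeroVec⇒≡zeroVec v⊑0))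

  zeroVec∈InProjGraver : ∀ {k} → InProjGraver n (2 ℕ.+ k) (A ++ replicate (2 ℕ.+ k) a) zeroVec
  zeroVec∈InProjGraver {k} with ≡-dec _≟_ a zeroVec
  ... | yes refl = InProjGraver-intro (A ++ replicate (2 ℕ.+ k) a) (1ℤ ∷ zeroVec)
                     (InGraver-padLeft A (replicate (2 ℕ.+ k) a) (InGraver-unit (replicate (suc k) a)))
  ... | no  a≢0  = InProjGraver-intro (A ++ replicate (2 ℕ.+ k) a) (1ℤ ∷ -1ℤ ∷ zeroVec)
                     (InGraver-padLeft A (replicate (2 ℕ.+ k) a) (InGraver-pair (replicate k a) a≢0))

  InProjGraver-replicate⇔ : ∀ {k} → k ≥ 2 → ∀ w →
                            InProjGraver n k (A ++ replicate k a) w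
                            ⇔ (InProjGraver n 1 (A ++ (a ∷ [])) w ⊎ w ≡ zeroVec)
  InProjGraver-replicate⇔ (s≤s (s≤s _)) w =
    mk⇔ InProjGraver-collapse [ InProjGraver-expand , (λ { refl → zeroVec∈InProjGraver }) ]

lemma3p3 : ∀ {d n k} (A : Matrix d n) (a : Vec ℤ d) (s : Vec Sign k) → k ≥ 2 →
           (w : Vec ℤ n) →
           InProjGraver n k (A ++ map (λ σ → signed σ a) s) w
             ⇔ (InProjGraver n 1 (A ++ (a ∷ [])) w ⊎ w ≡ zeroVec)
lemma3p3 A a s k≥2 w = ⇔-trans (InProjGraver-signed⇔ A a s w) (InProjGraver-replicate⇔ A a k≥2 w)
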